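{- Let $\Gamma=(V,E)$ be a finite simple graph with an acyclic orientation and induced partial order $<$, $G$ a Lie group, $W$ a finite-dimensional vector space, $\rho:G\to\mathrm{GL}(W)$ a representation, and $A$ a connection. Let $F$ be the $\mathrm{End}(W)$-valued $2$-form with $F(i,j,k)=\rho(A(i,j)A(j,k))-\rho(A(i,k))$ for every ordered triple whose entries form a $3$-clique, and $F=0$ on all other triples. Then $d_AF=0$.
   Context: A $k$-clique is a $k$-subset of $V$ of pairwise adjacent vertices. $i<j$ iff there is a directed path from $i$ to $j$. A connection is a map $A$ on ordered pairs $(i,j)$ with $\{i,j\}\in E$, $A(i,j)\in G$, $A(j,i)=A(i,j)^{ -1}$. An $\mathrm{End}(W)$-valued $k$-form is a map $V^{k+1}\to\mathrm{End}(W)$ vanishing on tuples whose entries do not form a $(k+1)$-clique. The exterior covariant derivative of an $\mathrm{End}(W)$-valued $k$-form $\varphi$ is the $\mathrm{End}(W)$-valued $(k+1)$-form given, on tuples whose entries form a $(k+2)$-clique, by $(d_A\varphi)(i_0,\dots,i_{k+1})=\rho(A(i_0,i_1))\varphi(i_1,\dots,i_{k+1})+\sum_{j=1}^{k}(-1)^j\varphi(i_0,\dots,\widehat{i_j},\dots,i_{k+1})+(-1)^{k+1}\varphi(i_0,\dots,i_k)\rho(A(i_k,i_{k+1}))$, and zero on other tuples. -}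

module Defs where

open import Level using (Level; _⊔_) renaming (suc to lsuc)
open import Data.Nat using (ℕ; zero; suc)
open import Data.Fin using (Fin; zero; suc; inject₁; fromℕ; punchIn; toℕ)
open import Data.Fin.Properties using (all?; _≟_)
open import Data.Product using (Σ; _×_; _,_)
open import Data.Sum using (_⊎_)
open import Relation.Nullary using (¬_; Dec; yes; no)
open import Relation.Nullary.Decidable.Core using (_→-dec_; ¬?)
open import Relation.Binary.PropositionalEquality using (_≢_)
open import Relation.Binary.Construct.Closure.Transitive using (TransClosure)
open import Algebra.Bundles using (CommutativeRing; Group)

record IsField {c ℓ} (K : CommutativeRing c ℓ) : Set (c ⊔ ℓ) where
  open CommutativeRing K
  field
    0≉1     : ¬ (0# ≈ 1#)
    inverse : ∀ x → ¬ (x ≈ 0#) → Σ Carrier (λ y → x * y ≈ 1#)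

-- End(W) for W = K^d (a d-dimensional K-vector space): d×d matrices.

module Matrices {c ℓ} (K : CommutativeRing c ℓ) (d : ℕ) where
  open CommutativeRing K using (Carrier; _≈_; _+_; _*_; -_; 0#; 1#)

  Mat : Set c
  Mat = Fin d → Fin d → Carrier

  infix 4 _≈M_
  _≈M_ : Mat → Mat → Set ℓ
  M ≈M N = ∀ a b → M a b ≈ N a b

  ΣK : ∀ {m} → (Fin m → Carrier) → Carrier
  ΣK {zero}  f = 0#
  ΣK {suc m} f = f zero + ΣK (λ i → f (suc i))

  0M : Mat
  0M a b = 0#

  1M : Mat
  1M a b with a ≟ b
  ... | yes _ = 1#
  ... | no  _ = 0#

  infixl 6 _+M_ _-M_
  infixl 7 _*M_
  _+M_ : Mat → Mat → Mat
  (M +M N) a b = M a b + N a b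

  -M_ : Mat → Mat
  (-M M) a b = - M a b

  _-M_ : Mat → Mat → Mat
  M -M N = M +M (-M N)

  _*M_ : Mat → Mat → Mat
  (M *M N) a b = ΣK (λ e → M a e * N e b)

  ΣM : ∀ {m} → (Fin m → Mat) → Mat
  ΣM {zero}  f = 0M
  ΣM {suc m} f = f zero +M ΣM (λ i → f (suc i))

  sign : ℕ → Mat → Mat
  sign zero    M = M
  sign (suc j) M = -M (sign j M)

  -- A representation ρ : G → GL(W) (a group homomorphism into the
  -- invertible matrices; invertibility of ρ g follows from the laws).
  record Representation {g gℓ} (G : Group g gℓ) : Set (c ⊔ ℓ ⊔ g ⊔ gℓ) where
    open Group G using (_∙_; ε) renaming (Carrier to ∣G∣; _≈_ to _≈G_)
    field
      ρ      : ∣G∣ → Mat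
      ρ-cong : ∀ {x y} → x ≈G y → ρ x ≈M ρ y
      ρ-hom  : ∀ x y → ρ (x ∙ y) ≈M ρ x *M ρ y
      ρ-ε    : ρ ε ≈M 1M

record SimpleGraph (n : ℕ) : Set₁ where
  field
    Adj    : Fin n → Fin n → Set
    adj?   : ∀ i j → Dec (Adj i j)
    sym    : ∀ {i j} → Adj i j → Adj j i
    irrefl : ∀ i → ¬ Adj i i

  -- the entries of a tuple t form an m-clique (m = length of t):
  -- they are pairwise adjacent (hence, by irreflexivity, pairwise distinct).
  IsCliqueTuple : ∀ {m} → (Fin m → Fin n) → Set
  IsCliqueTuple t = ∀ p q → p ≢ q → Adj (t p) (t q)

  isCliqueTuple? : ∀ {m} (t : Fin m → Fin n) → Dec (IsCliqueTuple t)
  isCliqueTuple? t = all? (λ p → all? (λ q → ¬? (p ≟ q) →-dec adj? (t p) (t q)))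

record AcyclicOrientation {n : ℕ} (Γ : SimpleGraph n) : Set₁ where
  open SimpleGraph Γ
  field
    _⇒_       : Fin n → Fin n → Set
    ⇒-edge    : ∀ {i j} → i ⇒ j → Adj i j
    ⇒-total   : ∀ {i j} → Adj i j → (i ⇒ j) ⊎ (j ⇒ i)
    ⇒-asym    : ∀ {i j} → i ⇒ j → ¬ (j ⇒ i)
    acyclic   : ∀ i → ¬ TransClosure _⇒_ i i

  _<_ : Fin n → Fin n → Set
  i < j = TransClosure _⇒_ i j

module Gauge {c ℓ g gℓ} (K : CommutativeRing c ℓ) (d : ℕ)
             (G : Group g gℓ) (n : ℕ) (Γ : SimpleGraph n) where
  open Matrices K d
  open SimpleGraph Γ
  open Group G using (_∙_; _⁻¹) renaming (Carrier to ∣G∣; _≈_ to _≈G_)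

  -- A connection: a G-value on each ordered pair (i,j) with {i,j} ∈ E
  -- (represented as a total function whose values off edges are unused),
  -- with A(j,i) = A(i,j)⁻¹ on edges.
  record Connection : Set (g ⊔ gℓ) where
    field
      A     : Fin n → Fin n → ∣G∣
      A-inv : ∀ i j → Adj i j → A j i ≈G (A i j) ⁻¹

  Form : ℕ → Set c
  Form k = (Fin (suc k) → Fin n) → Mat

  IsForm : ∀ {k} → Form k → Set (ℓ)
  IsForm {k} φ = ∀ t → ¬ IsCliqueTuple t → φ t ≈M 0M

  module _ (R : Representation G) (C : Connection) where
    open Representation R
    open Connection C

    dA : ∀ {k} → Form k → Form (suc k)
    dA {k} φ t with isCliqueTuple? t
    ... | no  _ = 0M
    ... | yes _ =
          ρ (A (t zero) (t (suc zero))) *M φ (λ p → t (suc p))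
       +M ΣM (λ (j : Fin k) →
               sign (suc (toℕ j)) (φ (λ p → t (punchIn (suc (inject₁ j)) p))))
       +M sign (suc k) (φ (λ p → t (inject₁ p)) *M
                        ρ (A (t (inject₁ (fromℕ k))) (t (fromℕ (suc k)))))

    F : Form 2
    F t with isCliqueTuple? t
    ... | no  _ = 0M
    ... | yes _ = ρ (A (t zero) (t (suc zero)) ∙ A (t (suc zero)) (t (suc (suc zero))))
                  -M ρ (A (t zero) (t (suc (suc zero))))

-- On a 4-clique t, write Xᵢⱼ = ρ(A(tᵢ,tⱼ)). Since ρ is multiplicative, each of the four
-- terms of d_A F(t₀,t₁,t₂,t₃) is a difference of two of the path products X₀₁X₁₂X₂₃,
-- X₀₁X₁₃, X₀₂X₂₃, X₀₃ from t₀ to t₃, and in the alternating sum every path product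
-- occurs once with each sign.
module Submission where

open import Defs
open import Level using (Level)
open import Data.Nat using (ℕ; zero; suc)
open import Data.Fin using (Fin; zero; suc; inject₁; punchIn)
open import Data.Fin.Patterns using (0F; 1F; 2F; 3F)
open import Data.Fin.Properties using (suc-injective; inject₁-injective; punchIn-injective)
open import Data.Empty using (⊥-elim)
open import Function using (_∘_; Injective)
open import Relation.Nullary using (yes; no)
open import Relation.Binary.Bundles using (Setoid)
open import Relation.Binary.PropositionalEquality using (_≡_)
import Relation.Binary.PropositionalEquality as ≡
import Relation.Binary.Reasoning.Setoid as SetoidReasoning
open import Algebra.Bundles using (CommutativeRing; Group; AbelianGroup)
import Algebra.Properties.AbelianGroup as AbelianGroupProperties
import Algebra.Properties.Ring as RingProperties
import Algebra.Properties.Semiring.Sum as SemiringSum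
import Algebra.Solver.CommutativeMonoid as CommutativeMonoidSolver

module AlternatingSum {a ℓ} (𝔾 : AbelianGroup a ℓ) where
  open AbelianGroup 𝔾
  open AbelianGroupProperties 𝔾 using (⁻¹-involutive; ⁻¹-anti-homo‿-)
  open CommutativeMonoidSolver commutativeMonoid using (solve; _⊕_; _⊜_)
  open SetoidReasoning setoid

  -- The left-hand side is the unfolded shape of an entry of d_A φ for a 2-form φ: the
  -- signs (-1)ʲ are iterated inverses and the middle sum over j ends in ε.
  alternating-face-sum≈ε : ∀ {p q r s u v w x} →
    p ≈ u ∙ v ⁻¹ → q ≈ w ∙ x ⁻¹ → r ≈ v ∙ x ⁻¹ → s ≈ u ∙ w ⁻¹ →
    p ∙ (q ⁻¹ ∙ (r ⁻¹ ⁻¹ ∙ ε)) ∙ s ⁻¹ ⁻¹ ⁻¹ ≈ ε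
  alternating-face-sum≈ε {p} {q} {r} {s} {u} {v} {w} {x} p≈ q≈ r≈ s≈ = begin
    p ∙ (q ⁻¹ ∙ (r ⁻¹ ⁻¹ ∙ ε)) ∙ s ⁻¹ ⁻¹ ⁻¹
      ≈⟨ ∙-cong (∙-congˡ (∙-cong (⁻¹-cong q≈) (trans (identityʳ _) (⁻¹-involutive r))))
                (⁻¹-involutive (s ⁻¹)) ⟩
    p ∙ ((w ∙ x ⁻¹) ⁻¹ ∙ r) ∙ s ⁻¹
      ≈⟨ ∙-cong (∙-cong p≈ (∙-cong (⁻¹-anti-homo‿- w x) r≈))
                (trans (⁻¹-cong s≈) (⁻¹-anti-homo‿- u w)) ⟩
    (u ∙ v ⁻¹) ∙ ((x ∙ w ⁻¹) ∙ (v ∙ x ⁻¹)) ∙ (w ∙ u ⁻¹)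
      ≈⟨ solve 8 (λ u v w x u′ v′ w′ x′ →
                    ((u ⊕ v′) ⊕ ((x ⊕ w′) ⊕ (v ⊕ x′))) ⊕ (w ⊕ u′)
                  ⊜ (u ⊕ u′) ⊕ ((v ⊕ v′) ⊕ ((w ⊕ w′) ⊕ (x ⊕ x′))))
                refl u v w x (u ⁻¹) (v ⁻¹) (w ⁻¹) (x ⁻¹) ⟩
    (u ∙ u ⁻¹) ∙ ((v ∙ v ⁻¹) ∙ ((w ∙ w ⁻¹) ∙ (x ∙ x ⁻¹)))
      ≈⟨ ∙-cong (inverseʳ u) (∙-cong (inverseʳ v) (∙-cong (inverseʳ w) (inverseʳ x))) ⟩
    ε ∙ (ε ∙ (ε ∙ ε))
      ≈⟨ trans (identityˡ _) (trans (identityˡ _) (identityˡ _)) ⟩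
    ε ∎

module MatrixProperties {c ℓ} (K : CommutativeRing c ℓ) (d : ℕ) where
  open CommutativeRing K hiding (zero)
  open Matrices K d
  open SemiringSum semiring
    using (sum; sum-cong-≋; sum-cong-≗; ∑-distrib-+; ∑-comm; *-distribˡ-sum; *-distribʳ-sum)
  open RingProperties ring using (-1*x≈-x; x[y-z]≈xy-xz; [y-z]x≈yx-zx)
  open SetoidReasoning setoid

  ≈M-setoid : Setoid c ℓ
  ≈M-setoid = record
    { Carrier       = Mat
    ; _≈_           = _≈M_
    ; isEquivalence = record
      { refl  = λ _ _ → refl
      ; sym   = λ M≈N a b → sym (M≈N a b)
      ; trans = λ M≈N N≈Q a b → trans (M≈N a b) (N≈Q a b)
      }
    }

  -M-cong : ∀ {M M′ N N′} → M ≈M M′ → N ≈M N′ → M -M N ≈M M′ -M N′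
  -M-cong M≈M′ N≈N′ a b = +-cong (M≈M′ a b) (-‿cong (N≈N′ a b))

  ΣK≡sum : ∀ {m} (f : Fin m → Carrier) → ΣK f ≡ sum f
  ΣK≡sum {zero}  f = ≡.refl
  ΣK≡sum {suc m} f = ≡.cong (f zero +_) (ΣK≡sum (f ∘ suc))

  ΣK-cong : ∀ {m} {f g : Fin m → Carrier} → (∀ i → f i ≈ g i) → ΣK f ≈ ΣK g
  ΣK-cong {f = f} {g} f≈g = begin
    ΣK f   ≡⟨ ΣK≡sum f ⟩
    sum f  ≈⟨ sum-cong-≋ f≈g ⟩
    sum g  ≡⟨ ΣK≡sum g ⟨
    ΣK g   ∎

  ΣK-comm : ∀ {m k} (f : Fin m → Fin k → Carrier) →
    ΣK (λ i → ΣK (f i)) ≈ ΣK (λ j → ΣK (λ i → f i j))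
  ΣK-comm f = begin
    ΣK (λ i → ΣK (f i))             ≡⟨ ΣK²≡sum² f ⟩
    sum (λ i → sum (f i))           ≈⟨ ∑-comm f ⟩
    sum (λ j → sum (λ i → f i j))   ≡⟨ ΣK²≡sum² (λ j i → f i j) ⟨
    ΣK (λ j → ΣK (λ i → f i j))     ∎
    where
      ΣK²≡sum² : ∀ {m k} (h : Fin m → Fin k → Carrier) → ΣK (ΣK ∘ h) ≡ sum (sum ∘ h)
      ΣK²≡sum² h = ≡.trans (ΣK≡sum (ΣK ∘ h)) (sum-cong-≗ (ΣK≡sum ∘ h))

  *-distribˡ-ΣK : ∀ {m} x (f : Fin m → Carrier) → x * ΣK f ≈ ΣK (λ i → x * f i)
  *-distribˡ-ΣK x f = begin
    x * ΣK f               ≡⟨ ≡.cong (x *_) (ΣK≡sum f) ⟩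
    x * sum f              ≈⟨ *-distribˡ-sum x f ⟩
    sum (λ i → x * f i)    ≡⟨ ΣK≡sum (λ i → x * f i) ⟨
    ΣK (λ i → x * f i)     ∎

  *-distribʳ-ΣK : ∀ {m} x (f : Fin m → Carrier) → ΣK f * x ≈ ΣK (λ i → f i * x)
  *-distribʳ-ΣK x f = begin
    ΣK f * x               ≡⟨ ≡.cong (_* x) (ΣK≡sum f) ⟩
    sum f * x              ≈⟨ *-distribʳ-sum x f ⟩
    sum (λ i → f i * x)    ≡⟨ ΣK≡sum (λ i → f i * x) ⟨
    ΣK (λ i → f i * x)     ∎

  -‿distrib-ΣK : ∀ {m} (f : Fin m → Carrier) → - ΣK f ≈ ΣK (λ i → - f i)
  -‿distrib-ΣK f = begin
    - ΣK f                    ≈⟨ -1*x≈-x _ ⟨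
    - 1# * ΣK f               ≈⟨ *-distribˡ-ΣK (- 1#) f ⟩
    ΣK (λ i → - 1# * f i)     ≈⟨ ΣK-cong (-1*x≈-x ∘ f) ⟩
    ΣK (λ i → - f i)          ∎

  ΣK-distrib-− : ∀ {m} (f g : Fin m → Carrier) → ΣK (λ i → f i + - g i) ≈ ΣK f + - ΣK g
  ΣK-distrib-− f g = begin
    ΣK (λ i → f i + - g i)         ≡⟨ ΣK≡sum (λ i → f i + - g i) ⟩
    sum (λ i → f i + - g i)        ≈⟨ ∑-distrib-+ f (λ i → - g i) ⟩
    sum f + sum (λ i → - g i)      ≡⟨ ≡.cong₂ _+_ (ΣK≡sum f) (ΣK≡sum (λ i → - g i)) ⟨
    ΣK f + ΣK (λ i → - g i)        ≈⟨ +-congˡ (-‿distrib-ΣK g) ⟨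
    ΣK f + - ΣK g                  ∎

  *M-cong : ∀ {M M′ N N′} → M ≈M M′ → N ≈M N′ → M *M N ≈M M′ *M N′
  *M-cong M≈M′ N≈N′ a b = ΣK-cong {d} (λ e → *-cong (M≈M′ a e) (N≈N′ e b))

  *M-assoc : ∀ M N Q → M *M (N *M Q) ≈M (M *M N) *M Q
  *M-assoc M N Q a b = begin
    ΣK (λ f → M a f * ΣK (λ e → N f e * Q e b))
      ≈⟨ ΣK-cong {d} (λ f → *-distribˡ-ΣK {d} (M a f) _) ⟩
    ΣK (λ f → ΣK (λ e → M a f * (N f e * Q e b)))
      ≈⟨ ΣK-comm {d} {d} _ ⟩
    ΣK (λ e → ΣK (λ f → M a f * (N f e * Q e b)))
      ≈⟨ ΣK-cong {d} (λ e → ΣK-cong {d} (λ f → *-assoc _ _ _)) ⟨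
    ΣK (λ e → ΣK (λ f → M a f * N f e * Q e b))
      ≈⟨ ΣK-cong {d} (λ e → *-distribʳ-ΣK {d} (Q e b) _) ⟨
    ΣK (λ e → ΣK (λ f → M a f * N f e) * Q e b)
      ∎

  M[N-Q]≈MN-MQ : ∀ M N Q → M *M (N -M Q) ≈M M *M N -M M *M Q
  M[N-Q]≈MN-MQ M N Q a b = begin
    ΣK (λ e → M a e * (N e b + - Q e b))            ≈⟨ ΣK-cong {d} (λ e → x[y-z]≈xy-xz _ _ _) ⟩
    ΣK (λ e → M a e * N e b + - (M a e * Q e b))    ≈⟨ ΣK-distrib-− {d} _ _ ⟩
    (M *M N -M M *M Q) a b                          ∎

  [N-Q]M≈NM-QM : ∀ M N Q → (N -M Q) *M M ≈M N *M M -M Q *M M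
  [N-Q]M≈NM-QM M N Q a b = begin
    ΣK (λ e → (N a e + - Q a e) * M e b)            ≈⟨ ΣK-cong {d} (λ e → [y-z]x≈yx-zx _ _ _) ⟩
    ΣK (λ e → N a e * M e b + - (Q a e * M e b))    ≈⟨ ΣK-distrib-− {d} _ _ ⟩
    (N *M M -M Q *M M) a b                          ∎

module CliqueTuples {n} (Γ : SimpleGraph n) where
  open SimpleGraph Γ

  isCliqueTuple-∘ : ∀ {m k} {t : Fin m → Fin n} {f : Fin k → Fin m} →
    Injective _≡_ _≡_ f → IsCliqueTuple t → IsCliqueTuple (t ∘ f)
  isCliqueTuple-∘ f-injective t-clique p q p≢q = t-clique _ _ (p≢q ∘ f-injective)

module Bianchi {c ℓ g gℓ} (K : CommutativeRing c ℓ) (d : ℕ) (G : Group g gℓ) (n : ℕ)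
  (Γ : SimpleGraph n) (R : Matrices.Representation K d G) (C : Gauge.Connection K d G n Γ) where
  open CommutativeRing K using (refl; +-cong; +-abelianGroup)
  open Matrices K d
  open MatrixProperties K d
  open Gauge K d G n Γ
  open SimpleGraph Γ using (IsCliqueTuple; isCliqueTuple?)
  open CliqueTuples Γ
  open Representation R
  open Connection C
  open AlternatingSum +-abelianGroup
  open SetoidReasoning ≈M-setoid

  X : Fin n → Fin n → Mat
  X i j = ρ (A i j)

  F-on-clique : ∀ s → IsCliqueTuple s →
    F R C s ≈M X (s 0F) (s 1F) *M X (s 1F) (s 2F) -M X (s 0F) (s 2F)
  F-on-clique s s-clique with isCliqueTuple? s
  ... | no ¬s-clique = ⊥-elim (¬s-clique s-clique)
  ... | yes _        = λ a b → +-cong (ρ-hom _ _ a b) refl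

  dA-F≈0M : ∀ t → dA R C (F R C) t ≈M 0M
  dA-F≈0M t with isCliqueTuple? t
  ... | no _         = λ _ _ → refl
  ... | yes t-clique = λ a b → alternating-face-sum≈ε (front a b)
      (face (punchIn 1F) (punchIn-injective 1F _ _) a b)
      (face (punchIn 2F) (punchIn-injective 2F _ _) a b)
      (back a b)
    where
      Y : Fin 4 → Fin 4 → Mat
      Y i j = X (t i) (t j)

      face : ∀ f → Injective _≡_ _≡_ f →
        F R C (t ∘ f) ≈M Y (f 0F) (f 1F) *M Y (f 1F) (f 2F) -M Y (f 0F) (f 2F)
      face f f-injective = F-on-clique (t ∘ f) (isCliqueTuple-∘ f-injective t-clique)

      front : Y 0F 1F *M F R C (t ∘ suc)
           ≈M Y 0F 1F *M Y 1F 2F *M Y 2F 3F -M Y 0F 1F *M Y 1F 3F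
      front = begin
        Y 0F 1F *M F R C (t ∘ suc)
          ≈⟨ *M-cong (λ _ _ → refl) (face suc suc-injective) ⟩
        Y 0F 1F *M (Y 1F 2F *M Y 2F 3F -M Y 1F 3F)
          ≈⟨ M[N-Q]≈MN-MQ _ _ _ ⟩
        Y 0F 1F *M (Y 1F 2F *M Y 2F 3F) -M Y 0F 1F *M Y 1F 3F
          ≈⟨ -M-cong (*M-assoc _ _ _) (λ _ _ → refl) ⟩
        Y 0F 1F *M Y 1F 2F *M Y 2F 3F -M Y 0F 1F *M Y 1F 3F
          ∎

      back : F R C (t ∘ inject₁) *M Y 2F 3F
          ≈M Y 0F 1F *M Y 1F 2F *M Y 2F 3F -M Y 0F 2F *M Y 2F 3F
      back = begin
        F R C (t ∘ inject₁) *M Y 2F 3F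
          ≈⟨ *M-cong (face inject₁ inject₁-injective) (λ _ _ → refl) ⟩
        (Y 0F 1F *M Y 1F 2F -M Y 0F 2F) *M Y 2F 3F
          ≈⟨ [N-Q]M≈NM-QM _ _ _ ⟩
        Y 0F 1F *M Y 1F 2F *M Y 2F 3F -M Y 0F 2F *M Y 2F 3F
          ∎

mainTheorem2 : ∀ {c ℓ g gℓ : Level}
    (K : CommutativeRing c ℓ) → IsField K → (d : ℕ)
    (G : Group g gℓ) (n : ℕ) (Γ : SimpleGraph n) → AcyclicOrientation Γ →
    (R : Matrices.Representation K d G) (C : Gauge.Connection K d G n Γ) →
    let open Matrices K d in
    let open Gauge K d G n Γ in
    ∀ t → dA R C (F R C) t ≈M 0M
mainTheorem2 K _ d G n Γ _ R C = Bianchi.dA-F≈0M K d G n Γ R C
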